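{- For any prime $q$ and any $\epsilon>0$, $\mathrm{RI}_\epsilon(\mathbf{EQ}_n,q)=O(1/\epsilon)$, where the constant in $O(\cdot)$ does not depend on $n$, $q$ or $\epsilon$.
   Context: $\mathbf{EQ}_n:[n]\times[n]\to\{0,1\}$ is $\mathbf{EQ}_n(x,y)=1$ iff $x=y$. For a predicate $P:\mathcal X\times\mathcal Y\to\{0,1\}$ and integer $q\ge2$, a probabilistic inner product encoding of $P$ modulo $q$ with error $\epsilon$ is a probability distribution $\mu$ over pairs of maps $(x\mapsto\vec x,\ y\mapsto\vec y)$ with $\vec x,\vec y\in\mathbb Z_q^\ell$ (for some $\ell$ depending on the pair) such that for every $x,y$, $\Pr_{\mu}\big[P(x,y)\ne[\sum_i\vec x_i\vec y_i\equiv0\pmod q]\big]\le\epsilon$. Its length is the maximum $\ell$ over pairs in the support of $\mu$; $\mathrm{RI}_\epsilon(P,q)$ is the minimum length of such a $\mu$.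
   Formalization: The error parameter ε ranges over the positive rationals. -}

module Defs where

open import Data.Nat using (ℕ; _≤_)
open import Data.Nat.Divisibility using (_∣?_)
open import Data.Fin using (Fin; toℕ; _≟_)
open import Data.Vec using (Vec; zipWith; foldr)
open import Data.List using (List; map; filter)
import Data.List as L
open import Data.Bool using (Bool; true; false; _xor_)
open import Data.Product using (_×_; _,_; proj₁; proj₂)
open import Data.List.Relation.Unary.All using (All)
open import Relation.Nullary.Decidable using (⌊_⌋)
open import Data.Rational using (ℚ; 0ℚ; 1ℚ; _+_) renaming (_≤_ to _≤ℚ_)
open import Relation.Binary.PropositionalEquality using (_≡_)
import Data.Nat as N

-- ℤ_q is represented by Fin q; arithmetic is done on representatives in ℕ
-- and the test "≡ 0 (mod q)" is divisibility by q.

innerℕ : ∀ {q ℓ} → Vec (Fin q) ℓ → Vec (Fin q) ℓ → ℕ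
innerℕ u v = foldr _ N._+_ 0 (zipWith (λ a b → toℕ a N.* toℕ b) u v)

ipZero : ∀ q {ℓ} → Vec (Fin q) ℓ → Vec (Fin q) ℓ → Bool
ipZero q u v = ⌊ q ∣? innerℕ u v ⌋

record EncPair (X Y : Set) (q : ℕ) : Set where
  constructor encPair
  field
    len  : ℕ
    encX : X → Vec (Fin q) len
    encY : Y → Vec (Fin q) len
open EncPair public

-- A finitely supported probability distribution over pairs of maps,
-- given as a list of (weight, pair) with nonnegative rational weights summing to 1.
Dist : (X Y : Set) (q : ℕ) → Set
Dist X Y q = List (ℚ × EncPair X Y q)

sumℚ : List ℚ → ℚ
sumℚ = L.foldr _+_ 0ℚ

IsProbDist : ∀ {X Y q} → Dist X Y q → Set
IsProbDist μ = All (λ p → 0ℚ ≤ℚ proj₁ p) μ × (sumℚ (map proj₁ μ) ≡ 1ℚ)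

errs : ∀ {X Y q} → (X → Y → Bool) → EncPair X Y q → X → Y → Bool
errs {q = q} P e x y = P x y xor ipZero q (encX e x) (encY e y)

errProb : ∀ {X Y q} → (X → Y → Bool) → Dist X Y q → X → Y → ℚ
errProb P μ x y = sumℚ (map (λ p → if errs P (proj₂ p) x y then proj₁ p else 0ℚ) μ)
  where open import Data.Bool using (if_then_else_)

-- μ is a probabilistic inner product encoding of P mod q with error ε and length ≤ L
-- (length = max ℓ over the support; zero-weight entries are also required to satisfy the bound)
IsEncoding : ∀ {X Y} → (X → Y → Bool) → (q : ℕ) → ℚ → ℕ → Dist X Y q → Set
IsEncoding {X} {Y} P q ε L μ =
  IsProbDist μ
  × (∀ (x : X) (y : Y) → errProb P μ x y ≤ℚ ε)
  × All (λ p → len (proj₂ p) ≤ L) μ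

RI≤ : ∀ {X Y} → (X → Y → Bool) → (q : ℕ) → ℚ → ℕ → Set
RI≤ {X} {Y} P q ε L = Data.Product.∃ (λ (μ : Dist X Y q) → IsEncoding P q ε L μ)
  where import Data.Product

EQ : (n : ℕ) → Fin n → Fin n → Bool
EQ n x y = ⌊ x ≟ y ⌋

-- Hash [n] into [m] with a uniformly random function h and encode x ↦ e_{h x}, y ↦ 𝟙 − e_{h y}
-- in ℤ_q^m. The inner product is 0 if h x = h y and 1 otherwise, and q ≥ 2 does not divide 1,
-- so the encoding errs exactly when distinct x, y collide under h, which happens for a 1/m
-- fraction of all h. For ε = p/d ≤ 1 the length m = ⌊d/p⌋ + 1 gives 1/m ≤ ε and m·ε ≤ 2;
-- for ε > 1 the empty encoding already has error at most 1.
module Submission where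

open import Defs
open import Data.Nat using (ℕ)

module Fractions where
  open import Data.Nat as ℕ using (ℕ; zero; suc; NonZero)
  open import Data.Integer as ℤ using (+_; -[1+_]; +≤+)
  import Data.Integer.Properties as ℤ
  open import Data.Rational using (mkℚ; *<*; 0ℚ; _<_; _≤_; _+_; _*_; _/_; toℚᵘ)
  import Data.Rational.Properties as ℚ
  open import Data.Rational.Unnormalised as ℚᵘ using (_≃_; *≡*; *≤*) renaming (_/_ to _/ᵘ_)
  import Data.Rational.Unnormalised.Properties as ℚᵘ
  open import Data.Product using (∃₂; _,_)
  open import Relation.Nullary using (contradiction)
  open import Relation.Binary.PropositionalEquality using (_≡_; refl; sym; trans; cong; cong₂; subst₂)

  toℚᵘ-/ : ∀ a d .{{_ : NonZero d}} → toℚᵘ (+ a / d) ≃ + a /ᵘ d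
  toℚᵘ-/ a (suc d) = ℚ.toℚᵘ-fromℚᵘ (+ a /ᵘ suc d)

  /-≡ : ∀ a d b e .{{_ : NonZero d}} .{{_ : NonZero e}} → a ℕ.* e ≡ b ℕ.* d → + a / d ≡ + b / e
  /-≡ a d@(suc _) b e@(suc _) ae≡bd = ℚ.toℚᵘ-injective (begin
    toℚᵘ (+ a / d) ≈⟨ toℚᵘ-/ a d ⟩
    + a /ᵘ d       ≈⟨ *≡* (trans (sym (ℤ.pos-* a e)) (trans (cong +_ ae≡bd) (ℤ.pos-* b d))) ⟩
    + b /ᵘ e       ≈⟨ toℚᵘ-/ b e ⟨
    toℚᵘ (+ b / e) ∎)
    where open ℚᵘ.≃-Reasoning

  /-mono-≤ : ∀ a d b e .{{_ : NonZero d}} .{{_ : NonZero e}} → a ℕ.* e ℕ.≤ b ℕ.* d → + a / d ≤ + b / e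
  /-mono-≤ a d@(suc _) b e@(suc _) ae≤bd = ℚ.toℚᵘ-cancel-≤ (begin
    toℚᵘ (+ a / d) ≃⟨ toℚᵘ-/ a d ⟩
    + a /ᵘ d       ≤⟨ *≤* (subst₂ ℤ._≤_ (ℤ.pos-* a e) (ℤ.pos-* b d) (+≤+ ae≤bd)) ⟩
    + b /ᵘ e       ≃⟨ toℚᵘ-/ b e ⟨
    toℚᵘ (+ b / e) ∎)
    where open ℚᵘ.≤-Reasoning

  /-+ : ∀ a b d .{{_ : NonZero d}} → + a / d + + b / d ≡ + (a ℕ.+ b) / d
  /-+ a b d@(suc _) = ℚ.toℚᵘ-injective (begin
    toℚᵘ (+ a / d + + b / d)            ≈⟨ ℚ.toℚᵘ-homo-+ (+ a / d) (+ b / d) ⟩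
    toℚᵘ (+ a / d) ℚᵘ.+ toℚᵘ (+ b / d)  ≈⟨ ℚᵘ.+-cong (toℚᵘ-/ a d) (toℚᵘ-/ b d) ⟩
    + a /ᵘ d ℚᵘ.+ + b /ᵘ d              ≈⟨ *≡* cross ⟩
    + (a ℕ.+ b) /ᵘ d                    ≈⟨ toℚᵘ-/ (a ℕ.+ b) d ⟨
    toℚᵘ (+ (a ℕ.+ b) / d)              ∎)
    where
    open ℚᵘ.≃-Reasoning
    cross : (+ a ℤ.* + d ℤ.+ + b ℤ.* + d) ℤ.* + d ≡ + (a ℕ.+ b) ℤ.* (+ d ℤ.* + d)
    cross = trans (cong (ℤ._* + d) (sym (ℤ.*-distribʳ-+ (+ d) (+ a) (+ b))))
      (trans (cong (λ s → s ℤ.* + d ℤ.* + d) (sym (ℤ.pos-+ a b))) (ℤ.*-assoc (+ (a ℕ.+ b)) (+ d) (+ d)))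

  n/1*/ : ∀ a b d .{{_ : NonZero d}} → + a / 1 * (+ b / d) ≡ + (a ℕ.* b) / d
  n/1*/ a b d@(suc _) = ℚ.toℚᵘ-injective (begin
    toℚᵘ (+ a / 1 * (+ b / d))           ≈⟨ ℚ.toℚᵘ-homo-* (+ a / 1) (+ b / d) ⟩
    toℚᵘ (+ a / 1) ℚᵘ.* toℚᵘ (+ b / d)   ≈⟨ ℚᵘ.*-cong (toℚᵘ-/ a 1) (toℚᵘ-/ b d) ⟩
    + a /ᵘ 1 ℚᵘ.* (+ b /ᵘ d)             ≈⟨ *≡* cross ⟩
    + (a ℕ.* b) /ᵘ d                     ≈⟨ toℚᵘ-/ (a ℕ.* b) d ⟨
    toℚᵘ (+ (a ℕ.* b) / d)               ∎)
    where
    open ℚᵘ.≃-Reasoning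
    cross : (+ a ℤ.* + b) ℤ.* + d ≡ + (a ℕ.* b) ℤ.* (+ 1 ℤ.* + d)
    cross = cong₂ ℤ._*_ (sym (ℤ.pos-* a b)) (sym (ℤ.*-identityˡ (+ d)))

  positive⇒/ : ∀ {ε} → 0ℚ < ε → ∃₂ λ a d → ε ≡ + suc a / suc d
  positive⇒/ {mkℚ (+ zero)   _ _} (*<* 0<0) = contradiction 0<0 (ℤ.<-irrefl refl)
  positive⇒/ {mkℚ -[1+ _ ] _ _} (*<* ())
  positive⇒/ {ε@(mkℚ (+ suc a) d _)} _ = a , d , sym (ℚ.↥p/↧p≡p ε)

module Quotients where
  open import Data.Nat using (suc; NonZero; _+_; _*_; _≤_; _/_; _%_)
  open import Data.Nat.Properties using (+-monoˡ-≤; +-mono-≤; <⇒≤; *-comm; +-identityʳ; module ≤-Reasoning)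
  open import Data.Nat.DivMod using (m≡m%n+[m/n]*n; m%n<n; m/n*n≤m)
  open import Relation.Binary.PropositionalEquality using (cong)
  open ≤-Reasoning

  m≤n*[1+m/n] : ∀ m n .{{_ : NonZero n}} → m ≤ n * suc (m / n)
  m≤n*[1+m/n] m n = begin
    m                   ≡⟨ m≡m%n+[m/n]*n m n ⟩
    m % n + m / n * n   ≤⟨ +-monoˡ-≤ (m / n * n) (<⇒≤ (m%n<n m n)) ⟩
    n + m / n * n       ≡⟨ *-comm (suc (m / n)) n ⟩
    n * suc (m / n)     ∎

  [1+m/n]*n≤2*m : ∀ m n .{{_ : NonZero n}} → n ≤ m → suc (m / n) * n ≤ 2 * m
  [1+m/n]*n≤2*m m n n≤m = begin
    n + m / n * n ≤⟨ +-mono-≤ n≤m (m/n*n≤m m n) ⟩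
    m + m         ≡⟨ cong (m +_) (+-identityʳ m) ⟨
    2 * m         ∎

module Counting where
  open import Data.Nat using (ℕ; zero; suc; _+_; _*_; _^_; _≤_; z≤n; s≤s)
  open import Data.Nat.Properties using (*-identityˡ; m≤n⇒m≤1+n)
  open import Data.Bool using (Bool; true; false; if_then_else_)
  open import Data.Fin using (Fin; zero; suc; _≟_)
  open import Data.List using (List; []; _∷_; [_]; _++_; map; length; allFin; cartesianProductWith)
  open import Data.List.Properties using (length-++; length-map; length-tabulate; map-tabulate)
  open import Data.Vec using (Vec; []; _∷_; lookup)
  open import Function using (_∘_; id; const)
  open import Relation.Nullary using (yes; no; contradiction)
  open import Relation.Nullary.Decidable using (⌊_⌋; ⌊⌋-map′; isYes≗does; dec-true)
  open import Relation.Binary.PropositionalEquality using (_≡_; _≢_; refl; sym; trans; cong; cong₂; module ≡-Reasoning)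
  open ≡-Reasoning

  count : ∀ {A : Set} → (A → Bool) → List A → ℕ
  count p []       = 0
  count p (a ∷ as) = if p a then suc (count p as) else count p as

  module _ {A : Set} where

    count-++ : ∀ (p : A → Bool) xs ys → count p (xs ++ ys) ≡ count p xs + count p ys
    count-++ p []       ys = refl
    count-++ p (x ∷ xs) ys with p x
    ... | true  = cong suc (count-++ p xs ys)
    ... | false = count-++ p xs ys

    count-cong : ∀ {p p′ : A → Bool} → (∀ a → p a ≡ p′ a) → ∀ xs → count p xs ≡ count p′ xs
    count-cong p≗p′ []       = refl
    count-cong p≗p′ (x ∷ xs) rewrite p≗p′ x | count-cong p≗p′ xs = refl

    count-const : ∀ b (xs : List A) → count (const b) xs ≡ (if b then length xs else 0)
    count-const true  []       = refl
    count-const true  (x ∷ xs) = cong suc (count-const true xs)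
    count-const false []       = refl
    count-const false (x ∷ xs) = count-const false xs

    count-≤-length : ∀ (p : A → Bool) xs → count p xs ≤ length xs
    count-≤-length p []       = z≤n
    count-≤-length p (x ∷ xs) with p x
    ... | true  = s≤s (count-≤-length p xs)
    ... | false = m≤n⇒m≤1+n (count-≤-length p xs)

    count-map : ∀ {B : Set} (p : B → Bool) (f : A → B) xs → count p (map f xs) ≡ count (p ∘ f) xs
    count-map p f []       = refl
    count-map p f (x ∷ xs) with p (f x)
    ... | true  = cong suc (count-map p f xs)
    ... | false = count-map p f xs

  module _ {A B C : Set} (f : A → B → C) where

    length-cartesianProductWith : ∀ as bs → length (cartesianProductWith f as bs) ≡ length as * length bs
    length-cartesianProductWith []       bs = refl
    length-cartesianProductWith (a ∷ as) bs = begin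
      length (map (f a) bs ++ cartesianProductWith f as bs)       ≡⟨ length-++ (map (f a) bs) ⟩
      length (map (f a) bs) + length (cartesianProductWith f as bs) ≡⟨ cong₂ _+_ (length-map (f a) bs) (length-cartesianProductWith as bs) ⟩
      length bs + length as * length bs                            ∎

    count-cartesianProductWith-∷ : ∀ p a as bs →
      count p (cartesianProductWith f (a ∷ as) bs) ≡ count (p ∘ f a) bs + count p (cartesianProductWith f as bs)
    count-cartesianProductWith-∷ p a as bs =
      trans (count-++ p (map (f a) bs) _) (cong (_+ _) (count-map p (f a) bs))

    count-cartesianProductWith-const : ∀ p as bs {k} → (∀ a → count (p ∘ f a) bs ≡ k) →
      count p (cartesianProductWith f as bs) ≡ length as * k
    count-cartesianProductWith-const p []       bs fibre = refl
    count-cartesianProductWith-const p (a ∷ as) bs fibre =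
      trans (count-cartesianProductWith-∷ p a as bs)
            (cong₂ _+_ (fibre a) (count-cartesianProductWith-const p as bs fibre))

    count-cartesianProductWith-fst : ∀ p (r : A → Bool) as bs → (∀ a b → p (f a b) ≡ r a) →
      count p (cartesianProductWith f as bs) ≡ count r as * length bs
    count-cartesianProductWith-fst p r []       bs p≡r = refl
    count-cartesianProductWith-fst p r (a ∷ as) bs p≡r = begin
      count p (cartesianProductWith f (a ∷ as) bs)
        ≡⟨ count-cartesianProductWith-∷ p a as bs ⟩
      count (p ∘ f a) bs + count p (cartesianProductWith f as bs)
        ≡⟨ cong₂ _+_ (trans (count-cong (p≡r a) bs) (count-const (r a) bs))
                     (count-cartesianProductWith-fst p r as bs p≡r) ⟩
      (if r a then length bs else 0) + count r as * length bs
        ≡⟨ step (r a) ⟩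
      count r (a ∷ as) * length bs ∎
      where
      step : ∀ b → (if b then length bs else 0) + count r as * length bs
                 ≡ (if b then suc (count r as) else count r as) * length bs
      step true  = refl
      step false = refl

  ⌊≟⌋-refl : ∀ {k} (a : Fin k) → ⌊ a ≟ a ⌋ ≡ true
  ⌊≟⌋-refl a = trans (isYes≗does (a ≟ a)) (dec-true (a ≟ a) refl)

  ⌊≟⌋-sym : ∀ {k} (a b : Fin k) → ⌊ a ≟ b ⌋ ≡ ⌊ b ≟ a ⌋
  ⌊≟⌋-sym a b with a ≟ b | b ≟ a
  ... | yes _   | yes _   = refl
  ... | no _    | no _    = refl
  ... | yes a≡b | no b≢a  = contradiction (sym a≡b) b≢a
  ... | no a≢b  | yes b≡a = contradiction (sym b≡a) a≢b

  length-allFin : ∀ m → length (allFin m) ≡ m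
  length-allFin m = length-tabulate {n = m} id

  allFin-suc : ∀ m → allFin (suc m) ≡ zero ∷ map suc (allFin m)
  allFin-suc m = cong (zero ∷_) (sym (map-tabulate id suc))

  count-allFin-≟ : ∀ {m} (c : Fin m) → count (λ c′ → ⌊ c′ ≟ c ⌋) (allFin m) ≡ 1
  count-allFin-≟ {suc m} zero = begin
    count (λ c′ → ⌊ c′ ≟ zero ⌋) (allFin (suc m))          ≡⟨ cong (count (λ c′ → ⌊ c′ ≟ zero ⌋)) (allFin-suc m) ⟩
    suc (count (λ c′ → ⌊ c′ ≟ zero ⌋) (map suc (allFin m))) ≡⟨ cong suc (count-map _ suc (allFin m)) ⟩
    suc (count (const false) (allFin m))                    ≡⟨ cong suc (count-const false (allFin m)) ⟩
    1                                                       ∎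
  count-allFin-≟ {suc m} (suc c) = begin
    count (λ c′ → ⌊ c′ ≟ suc c ⌋) (allFin (suc m))     ≡⟨ cong (count (λ c′ → ⌊ c′ ≟ suc c ⌋)) (allFin-suc m) ⟩
    count (λ c′ → ⌊ c′ ≟ suc c ⌋) (map suc (allFin m)) ≡⟨ count-map _ suc (allFin m) ⟩
    count (λ c′ → ⌊ suc c′ ≟ suc c ⌋) (allFin m)       ≡⟨ count-cong (λ c′ → ⌊⌋-map′ _ _ (c′ ≟ c)) (allFin m) ⟩
    count (λ c′ → ⌊ c′ ≟ c ⌋) (allFin m)               ≡⟨ count-allFin-≟ c ⟩
    1                                                 ∎

  allVecs : ∀ m n → List (Vec (Fin m) n)
  allVecs m zero    = [ [] ]
  allVecs m (suc n) = cartesianProductWith _∷_ (allFin m) (allVecs m n)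

  length-allVecs : ∀ m n → length (allVecs m n) ≡ m ^ n
  length-allVecs m zero    = refl
  length-allVecs m (suc n) = trans (length-cartesianProductWith _∷_ (allFin m) (allVecs m n))
                                   (cong₂ _*_ (length-allFin m) (length-allVecs m n))

  count-allVecs-fibres : ∀ {m n k} p → (∀ c → count (p ∘ (c ∷_)) (allVecs m n) ≡ k) →
    count p (allVecs m (suc n)) ≡ m * k
  count-allVecs-fibres {m} {n} {k} p fibre =
    trans (count-cartesianProductWith-const _∷_ p (allFin m) (allVecs m n) fibre)
          (cong (_* k) (length-allFin m))

  count-lookup-≟ : ∀ {m n} (j : Fin (suc n)) (c : Fin m) →
    count (λ v → ⌊ lookup v j ≟ c ⌋) (allVecs m (suc n)) ≡ m ^ n
  count-lookup-≟ {m} {n} zero c = begin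
    count (λ v → ⌊ lookup v zero ≟ c ⌋) (allVecs m (suc n))
      ≡⟨ count-cartesianProductWith-fst _∷_ _ (λ c′ → ⌊ c′ ≟ c ⌋) (allFin m) (allVecs m n) (λ _ _ → refl) ⟩
    count (λ c′ → ⌊ c′ ≟ c ⌋) (allFin m) * length (allVecs m n)
      ≡⟨ cong₂ _*_ (count-allFin-≟ c) (length-allVecs m n) ⟩
    1 * m ^ n
      ≡⟨ *-identityˡ (m ^ n) ⟩
    m ^ n ∎
  count-lookup-≟ {m} {suc n} (suc j) c = count-allVecs-fibres {m} _ (λ _ → count-lookup-≟ j c)

  count-collisions : ∀ {m n} {x y : Fin (suc n)} → x ≢ y →
    count (λ v → ⌊ lookup v x ≟ lookup v y ⌋) (allVecs m (suc n)) ≡ m ^ n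
  count-collisions {x = zero}  {zero}  x≢y = contradiction refl x≢y
  count-collisions {m} {suc n} {zero}  {suc j} _   = count-allVecs-fibres {m} _ λ c →
    trans (count-cong (λ w → ⌊≟⌋-sym c (lookup w j)) (allVecs m (suc n))) (count-lookup-≟ j c)
  count-collisions {m} {suc n} {suc i} {zero}  _   = count-allVecs-fibres {m} _ (count-lookup-≟ i)
  count-collisions {m} {suc n} {suc i} {suc j} i≢j =
    count-allVecs-fibres {m} _ (λ _ → count-collisions (i≢j ∘ cong suc))

module UniformEncodings where
  open import Data.Nat as ℕ using (NonZero; z≤n)
  open import Data.Nat.Properties using (*-comm; *-monoˡ-≤)
  open import Data.Bool using (Bool; true; false)
  open import Data.List using (List; []; _∷_; [_]; map; length)
  open import Data.List.Relation.Unary.All using (All; []; _∷_; universal)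
  open import Data.List.Relation.Unary.All.Properties using (map⁺)
  open import Data.Product using (_,_; proj₁)
  open import Data.Integer using (+_)
  open import Data.Rational using (0ℚ; 1ℚ; _≤_; _+_; _/_)
  import Data.Rational.Properties as ℚ
  open import Data.Vec using ([])
  open import Function using (const)
  open import Relation.Binary.PropositionalEquality using (_≡_; sym; trans; cong; subst)
  open Fractions
  open Counting

  uniform : ∀ {X Y q} (es : List (EncPair X Y q)) .{{_ : NonZero (length es)}} → Dist X Y q
  uniform es = map (+ 1 / length es ,_) es

  weights-sum : ∀ {X Y q} d .{{_ : NonZero d}} (es : List (EncPair X Y q)) →
    sumℚ (map proj₁ (map (+ 1 / d ,_) es)) ≡ + length es / d
  weights-sum d []       = sym (ℚ.0/n≡0 d)
  weights-sum d (e ∷ es) = trans (cong (_+_ (+ 1 / d)) (weights-sum d es)) (/-+ 1 (length es) d)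

  errProb-weighted : ∀ {X Y q} (P : X → Y → Bool) d .{{_ : NonZero d}} (es : List (EncPair X Y q)) x y →
    errProb P (map (+ 1 / d ,_) es) x y ≡ + count (λ e → errs P e x y) es / d
  errProb-weighted P d []       x y = sym (ℚ.0/n≡0 d)
  errProb-weighted P d (e ∷ es) x y with errs P e x y
  ... | true  = trans (cong (_+_ (+ 1 / d)) (errProb-weighted P d es x y)) (/-+ 1 _ d)
  ... | false = trans (ℚ.+-identityˡ _) (errProb-weighted P d es x y)

  uniform-isEncoding : ∀ {X Y q} (P : X → Y → Bool) {ε L} (es : List (EncPair X Y q))
    .{{_ : NonZero (length es)}} → All (λ e → len e ℕ.≤ L) es →
    (∀ x y → + count (λ e → errs P e x y) es / length es ≤ ε) →
    IsEncoding P q ε L (uniform es)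
  uniform-isEncoding P es lengths errors =
    (map⁺ (universal {P = λ _ → 0ℚ ≤ + 1 / length es} (λ _ → /-mono-≤ 0 1 1 (length es) z≤n) es) ,
     trans (weights-sum (length es) es) (/-≡ (length es) (length es) 1 1 (*-comm (length es) 1))) ,
    (λ x y → subst (_≤ _) (sym (errProb-weighted P (length es) es x y)) (errors x y)) ,
    map⁺ lengths

  RI≤-mono : ∀ {X Y} {P : X → Y → Bool} {q ε ε′ L} → ε ≤ ε′ → RI≤ P q ε L → RI≤ P q ε′ L
  RI≤-mono ε≤ε′ (μ , isDist , err , lengths) = μ , isDist , (λ x y → ℚ.≤-trans (err x y) ε≤ε′) , lengths

  RI≤-trivial : ∀ {X Y} (P : X → Y → Bool) q → RI≤ P q 1ℚ 0
  RI≤-trivial P q = uniform [ constant ] , uniform-isEncoding P [ constant ] (z≤n ∷ [])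
    (λ x y → /-mono-≤ (count (λ e → errs P e x y) [ constant ]) 1 1 1
      (*-monoˡ-≤ 1 (count-≤-length (λ e → errs P e x y) [ constant ])))
    where
    constant : EncPair _ _ q
    constant = encPair 0 (const []) (const [])

module HashEncoding (r : ℕ) where
  open import Data.Nat as ℕ using (suc; 2+; z≤n)
  import Data.Nat.Properties as ℕ
  open import Data.Nat.Divisibility using (_∣?_; _∣0; ∣1⇒≡1)
  open import Data.Bool using (if_then_else_; not; false; _xor_)
  open import Data.Fin using (Fin; zero; suc; _≟_)
  open import Data.Fin.Patterns using (0F; 1F)
  open import Data.Vec using (Vec; []; _∷_; replicate; lookup)
  open import Function using (_∘_)
  open import Relation.Nullary using (yes; no; contradiction)
  open import Relation.Nullary.Decidable using (⌊_⌋; ⌊⌋-map′; isYes≗does; dec-true; dec-false)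
  open import Relation.Binary.PropositionalEquality using (_≡_; refl; sym; trans; cong; subst)
  open Counting


  basis : ∀ {ℓ} → Fin ℓ → Vec (Fin (2+ r)) ℓ
  basis {suc ℓ} zero    = 1F ∷ replicate ℓ 0F
  basis {suc ℓ} (suc a) = 0F ∷ basis a

  basisComplement : ∀ {ℓ} → Fin ℓ → Vec (Fin (2+ r)) ℓ
  basisComplement {suc ℓ} zero    = 0F ∷ replicate ℓ 1F
  basisComplement {suc ℓ} (suc b) = 1F ∷ basisComplement b

  innerℕ-zeroˡ : ∀ {ℓ} (v : Vec (Fin (2+ r)) ℓ) → innerℕ (replicate ℓ 0F) v ≡ 0
  innerℕ-zeroˡ []      = refl
  innerℕ-zeroˡ (_ ∷ v) = innerℕ-zeroˡ v

  innerℕ-basis-ones : ∀ {ℓ} (a : Fin ℓ) → innerℕ (basis a) (replicate ℓ 1F) ≡ 1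
  innerℕ-basis-ones {suc ℓ} zero    = cong suc (innerℕ-zeroˡ (replicate ℓ 1F))
  innerℕ-basis-ones         (suc a) = innerℕ-basis-ones a

  innerℕ-basis-basisComplement : ∀ {ℓ} (a b : Fin ℓ) → innerℕ (basis a) (basisComplement b) ≡ (if ⌊ a ≟ b ⌋ then 0 else 1)
  innerℕ-basis-basisComplement {suc ℓ} zero    zero    = innerℕ-zeroˡ (replicate ℓ 1F)
  innerℕ-basis-basisComplement         zero    (suc b) = cong suc (innerℕ-zeroˡ (basisComplement b))
  innerℕ-basis-basisComplement         (suc a) zero    = innerℕ-basis-ones a
  innerℕ-basis-basisComplement         (suc a) (suc b) =
    trans (innerℕ-basis-basisComplement a b) (cong (if_then 0 else 1) (sym (⌊⌋-map′ _ _ (a ≟ b))))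

  ipZero-basis-basisComplement : ∀ {ℓ} (a b : Fin ℓ) → ipZero (2+ r) (basis a) (basisComplement b) ≡ ⌊ a ≟ b ⌋
  ipZero-basis-basisComplement a b rewrite innerℕ-basis-basisComplement a b with a ≟ b
  ... | yes _ = trans (isYes≗does (2+ r ∣? 0)) (dec-true (2+ r ∣? 0) (2+ r ∣0))
  ... | no _  = trans (isYes≗does (2+ r ∣? 1)) (dec-false (2+ r ∣? 1) (λ q∣1 → contradiction (∣1⇒≡1 q∣1) λ ()))

  hashEncoding : ∀ {m n} → Vec (Fin m) n → EncPair (Fin n) (Fin n) (2+ r)
  hashEncoding {m} h = encPair m (basis ∘ lookup h) (basisComplement ∘ lookup h)

  errs-hashEncoding : ∀ {m n} (h : Vec (Fin m) n) x y →
    errs (EQ n) (hashEncoding h) x y ≡ (⌊ x ≟ y ⌋ xor ⌊ lookup h x ≟ lookup h y ⌋)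
  errs-hashEncoding h x y = cong (⌊ x ≟ y ⌋ xor_) (ipZero-basis-basisComplement (lookup h x) (lookup h y))

  count-errs-hashEncoding : ∀ {m n} (x y : Fin n) →
    m ℕ.* count (λ h → errs (EQ n) (hashEncoding h) x y) (allVecs m n) ℕ.≤ m ℕ.^ n
  count-errs-hashEncoding {m} {suc n} x y = begin
    m ℕ.* count (λ h → errs (EQ (suc n)) (hashEncoding h) x y) (allVecs m (suc n))
      ≡⟨ cong (m ℕ.*_) (count-cong (λ h → errs-hashEncoding h x y) (allVecs m (suc n))) ⟩
    m ℕ.* count (λ h → ⌊ x ≟ y ⌋ xor ⌊ lookup h x ≟ lookup h y ⌋) (allVecs m (suc n))
      ≤⟨ ℕ.*-monoʳ-≤ m count≤ ⟩
    m ℕ.* m ℕ.^ n ∎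
    where
    open ℕ.≤-Reasoning
    count≤ : count (λ h → ⌊ x ≟ y ⌋ xor ⌊ lookup h x ≟ lookup h y ⌋) (allVecs m (suc n)) ℕ.≤ m ℕ.^ n
    count≤ with x ≟ y
    ... | no x≢y  = ℕ.≤-reflexive (count-collisions x≢y)
    ... | yes refl = subst (ℕ._≤ _) (sym no-errors) z≤n
      where
      no-errors : count (λ h → not ⌊ lookup h y ≟ lookup h y ⌋) (allVecs m (suc n)) ≡ 0
      no-errors = trans (count-cong (λ h → cong not (⌊≟⌋-refl (lookup h y))) (allVecs m (suc n)))
                        (count-const false (allVecs m (suc n)))

module EqualityEncoding where
  open import Data.Nat as ℕ using (suc; NonZero; NonTrivial; 2+; z≤n)
  import Data.Nat.Properties as ℕ
  open import Data.Fin using (Fin)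
  open import Data.List using (List; map; length)
  open import Data.List.Properties using (length-map)
  open import Data.List.Relation.Unary.All using (All; universal)
  open import Data.List.Relation.Unary.All.Properties using (map⁺)
  open import Data.Product using (∃; _×_; _,_)
  open import Data.Integer using (+_)
  open import Data.Rational using (1ℚ; _≤_; _*_; _/_)
  open import Relation.Nullary using (yes; no)
  open import Relation.Binary.PropositionalEquality using (_≡_; sym; trans; cong; subst; subst₂)
  open Fractions
  open Quotients
  open Counting
  open UniformEncodings
  open HashEncoding

  RI≤-EQ : ∀ q .{{_ : NonTrivial q}} n m .{{_ : NonZero m}} → RI≤ (EQ n) q (+ 1 / m) m
  RI≤-EQ (2+ r) n m = uniform es , uniform-isEncoding (EQ n) es lengths error-bound
    where
    es : List (EncPair (Fin n) (Fin n) (2+ r))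
    es = map (hashEncoding r) (allVecs m n)

    length-es : length es ≡ m ℕ.^ n
    length-es = trans (length-map (hashEncoding r) (allVecs m n)) (length-allVecs m n)

    instance
      es≢0 : NonZero (length es)
      es≢0 = subst NonZero (sym length-es) (ℕ.m^n≢0 m n)

    lengths : All (λ e → len e ℕ.≤ m) es
    lengths = map⁺ (universal (λ _ → ℕ.≤-refl) (allVecs m n))

    error-bound : ∀ x y → + count (λ e → errs (EQ n) e x y) es / length es ≤ + 1 / m
    error-bound x y = /-mono-≤ (count (λ e → errs (EQ n) e x y) es) (length es) 1 m (begin
      count (λ e → errs (EQ n) e x y) es ℕ.* m
        ≡⟨ cong (ℕ._* m) (count-map (λ e → errs (EQ n) e x y) (hashEncoding r) (allVecs m n)) ⟩
      count (λ h → errs (EQ n) (hashEncoding r h) x y) (allVecs m n) ℕ.* m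
        ≡⟨ ℕ.*-comm _ m ⟩
      m ℕ.* count (λ h → errs (EQ n) (hashEncoding r h) x y) (allVecs m n)
        ≤⟨ count-errs-hashEncoding r x y ⟩
      m ℕ.^ n
        ≡⟨ sym (trans (ℕ.*-identityˡ (length es)) length-es) ⟩
      1 ℕ.* length es ∎)
      where open ℕ.≤-Reasoning

  RI≤-EQ-2/ε : ∀ q .{{_ : NonTrivial q}} n p d .{{_ : NonZero p}} .{{_ : NonZero d}} →
    ∃ λ L → (+ L / 1) * (+ p / d) ≤ + 2 / 1 × RI≤ (EQ n) q (+ p / d) L
  RI≤-EQ-2/ε q n p d with p ℕ.≤? d
  ... | yes p≤d = L , L*ε≤2 , RI≤-mono {P = EQ n} 1/L≤ε (RI≤-EQ q n L)
    where
    L = suc (d ℕ./ p)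
    L*ε≤2 : (+ L / 1) * (+ p / d) ≤ + 2 / 1
    L*ε≤2 = subst (_≤ _) (sym (n/1*/ L p d)) (/-mono-≤ (L ℕ.* p) d 2 1
      (subst (ℕ._≤ 2 ℕ.* d) (sym (ℕ.*-identityʳ (L ℕ.* p))) ([1+m/n]*n≤2*m d p p≤d)))
    1/L≤ε : + 1 / L ≤ + p / d
    1/L≤ε = /-mono-≤ 1 L p d (subst (ℕ._≤ p ℕ.* L) (sym (ℕ.*-identityˡ d)) (m≤n*[1+m/n] d p))
  ... | no p≰d = 0 , 0*ε≤2 , RI≤-mono {P = EQ n} 1≤ε (RI≤-trivial (EQ n) q)
    where
    0*ε≤2 : (+ 0 / 1) * (+ p / d) ≤ + 2 / 1
    0*ε≤2 = subst (_≤ _) (sym (n/1*/ 0 p d)) (/-mono-≤ 0 d 2 1 z≤n)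
    1≤ε : 1ℚ ≤ + p / d
    1≤ε = /-mono-≤ 1 1 p d (subst₂ ℕ._≤_ (sym (ℕ.*-identityˡ d)) (sym (ℕ.*-identityʳ p)) (ℕ.<⇒≤ (ℕ.≰⇒> p≰d)))

open import Data.Nat using (suc)
open import Data.Nat.Primality using (Prime; prime)
open import Data.Product using (∃; _×_; _,_)
open import Data.Integer using (+_)
open import Data.Rational using (ℚ; 0ℚ; _<_; _≤_; _*_; _/_)
open import Relation.Binary.PropositionalEquality using (refl)
open Fractions using (positive⇒/)
open EqualityEncoding using (RI≤-EQ-2/ε)

corollary1 : ∃ λ (C : ℕ) → ∀ (q : ℕ) → Prime q → ∀ (ε : ℚ) → 0ℚ < ε → ∀ (n : ℕ) →
    ∃ λ (L : ℕ) → ((+ L / 1) * ε ≤ (+ C / 1)) × RI≤ (EQ n) q ε L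
corollary1 = 2 , bound
  where
  bound : ∀ q → Prime q → ∀ ε → 0ℚ < ε → ∀ n → ∃ λ L → ((+ L / 1) * ε ≤ (+ 2 / 1)) × RI≤ (EQ n) q ε L
  bound q (prime _) ε 0<ε n with positive⇒/ 0<ε
  ... | p , d , refl = RI≤-EQ-2/ε q n (suc p) (suc d)
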